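{- Let $n\ge1$ and let $D$ be an integer such that every collection of $n$ finite sets has discrepancy at most $D$. Suppose $\mathcal B=\{B_1,\dots,B_n\}$ is a collection of $n$ finite sets such that for each $i$, the set of elements of $B_i$ lying in no other $B_j$ ($j\neq i$) has at least $D-1$ elements. Then $\mathcal B$ is $\frac12$-splittable.
   Context: The discrepancy of $\mathcal B=\{B_1,\dots,B_n\}$ is $\min_S\max_{i}\big||B_i\cap S|-|B_i\setminus S|\big|$, the minimum over all sets $S$. The collection is $\frac12$-splittable if there is a set $S$ with $|S\cap B_i|\in\{\lfloor |B_i|/2\rfloor,\lceil |B_i|/2\rceil\}$ for all $i$ (equivalently, discrepancy at most $1$). -}

module Defs where

open import Data.Nat using (ℕ; ⌊_/2⌋; ⌈_/2⌉)
open import Data.Integer using (ℤ; +_; _-_; _≤_) renaming (∣_∣ to absℤ)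
open import Data.Bool using (Bool; _∧_; not)
open import Data.Fin using (Fin; _≟_)
open import Data.Fin.Subset using (Subset; _∩_; ∁; ∣_∣)
open import Data.Vec using (lookup; tabulate)
open import Data.Bool.ListAction using (any)
open import Data.List using () renaming (allFin to allFinL)
open import Data.Product using (∃)
open import Data.Sum using (_⊎_)
open import Relation.Binary.PropositionalEquality using (_≡_)
open import Relation.Nullary.Decidable using (⌊_⌋)

Collection : ℕ → ℕ → Set
Collection n m = Fin n → Subset m

imbalance : ∀ {m} → Subset m → Subset m → ℕ
imbalance B S = absℤ ((+ ∣ B ∩ S ∣) - (+ ∣ B ∩ ∁ S ∣))

-- disc(𝓑) ≤ D, i.e. min_S max_i imbalance(B_i,S) ≤ D (minimum over a finite set)
DiscAtMost : ∀ {n m} → Collection n m → ℤ → Set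
DiscAtMost {n} {m} B D = ∃ λ (S : Subset m) → ∀ (i : Fin n) → + imbalance (B i) S ≤ D

HalfSplittable : ∀ {n m} → Collection n m → Set
HalfSplittable {n} {m} B = ∃ λ (S : Subset m) → ∀ (i : Fin n) →
  (∣ B i ∩ S ∣ ≡ ⌊ ∣ B i ∣ /2⌋) ⊎ (∣ B i ∩ S ∣ ≡ ⌈ ∣ B i ∣ /2⌉)

inOther : ∀ {n m} → Collection n m → Fin n → Fin m → Bool
inOther {n} B i x = any (λ j → not ⌊ j ≟ i ⌋ ∧ lookup (B j) x) (allFinL n)

privatePart : ∀ {n m} → Collection n m → Fin n → Subset m
privatePart B i = tabulate (λ x → lookup (B i) x ∧ not (inOther B i x))

-- Delete the private elements. The remaining n sets have a colouring S₀ of discrepancy at most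
-- D ≤ |Pᵢ| + 1, where Pᵢ is the private part of Bᵢ. Now recolour only private elements, one at a
-- time: an element of Pᵢ lies in no other set, so its colour affects Bᵢ alone, and colouring it so
-- as to move the current bias of Bᵢ one step toward 0 keeps |bias| ≤ (private elements left) + 1.
-- After all of Pᵢ is coloured, |bias Bᵢ| ≤ 1, which is 1/2-splittability.
module Submission where

open import Defs
open import Data.Nat using (ℕ; zero; suc; _≥_; ⌊_/2⌋; ⌈_/2⌉; z≤n; s≤s)
import Data.Nat as ℕ
import Data.Nat.Properties as ℕ
open import Data.Integer using (ℤ; +_; -[1+_]; _+_; _-_; _≤_; _⊖_; 0ℤ; 1ℤ; -1ℤ)
import Data.Integer as ℤ
import Data.Integer.Properties as ℤ
open import Data.Integer.Tactic.RingSolver using (solve-∀)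
open import Data.Bool using (Bool; true; false; _∧_; not; T; T?; if_then_else_)
open import Data.Bool.Properties using (T-∧)
open import Data.Fin using (Fin; zero; suc; _≟_)
open import Data.Fin.Properties using (any?)
open import Data.Fin.Subset using (Subset; _∩_; ∁; ∣_∣)
open import Data.Vec using ([]; _∷_; lookup; tabulate)
open import Data.Vec.Properties using (lookup∘tabulate)
open import Data.Vec.Functional using (Vector; tail)
import Data.Vec.Functional as Vector
open import Data.List.Membership.Propositional using (lose)
open import Data.List.Membership.Propositional.Properties using (∈-allFin)
open import Data.List.Relation.Unary.Any.Properties using (any⁺)
open import Data.Product using (∃; _×_; _,_; proj₁; proj₂)
open import Data.Sum using (_⊎_; inj₁; inj₂) renaming (map to ⊎-map)
open import Data.Empty using (⊥-elim)
open import Function using (_∘_; Equivalence)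
open import Relation.Nullary using (¬_; yes; no; contradiction)
open import Relation.Nullary.Decidable using (⌊_⌋)
open import Relation.Binary.PropositionalEquality
open import Algebra.Properties.CommutativeMonoid.Sum ℤ.+-0-commutativeMonoid
  using (sum; sum-cong-≗; ∑-distrib-+)
open import Algebra.Properties.Monoid.Sum ℕ.+-0-monoid using () renaming (sum to sumℕ)

-- Subsets of Fin m as characteristic functions; bias B S = |B ∩ S| - |B ∖ S|.

contribution : Bool → Bool → ℤ
contribution false _     = 0ℤ
contribution true  true  = 1ℤ
contribution true  false = -1ℤ

bias : ∀ {m} → Vector Bool m → Vector Bool m → ℤ
bias B S = sum (λ x → contribution (B x) (S x))

size : ∀ {m} → Vector Bool m → ℕ
size P = sumℕ (λ x → if P x then 1 else 0)

_∖_ : ∀ {m} → Vector Bool m → Vector Bool m → Vector Bool m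
(B ∖ P) x = B x ∧ not (P x)

towardZero : ℤ → Bool
towardZero (+ _)    = false
towardZero -[1+ _ ] = true

∣i+towardZero∣≤ : ∀ i k → ℤ.∣ i ∣ ℕ.≤ suc (suc k) →
                  ℤ.∣ i + contribution true (towardZero i) ∣ ℕ.≤ suc k
∣i+towardZero∣≤ (+ zero)     k _       = s≤s z≤n
∣i+towardZero∣≤ (+ suc j)    k (s≤s h) = h
∣i+towardZero∣≤ -[1+ zero ]  k _       = z≤n
∣i+towardZero∣≤ -[1+ suc j ] k (s≤s h) = h

∣i∣≤k⇒∣i+0∣≤k : ∀ i {k} → ℤ.∣ i ∣ ℕ.≤ k → ℤ.∣ i + 0ℤ ∣ ℕ.≤ k
∣i∣≤k⇒∣i+0∣≤k i {k} = subst (λ j → ℤ.∣ j ∣ ℕ.≤ k) (sym (ℤ.+-identityʳ i))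

-- p i says whether the element lies in the i-th private part; the owner, if any, gets the colour
-- moving d toward 0, and an unowned element keeps its colour s.
colourElement : ∀ {n} (p : Fin n → Bool) → (∀ {i j} → T (p i) → T (p j) → i ≡ j) →
                (d : Fin n → ℤ) (k : Fin n → ℕ) →
                (∀ i → ℤ.∣ d i ∣ ℕ.≤ suc ((if p i then 1 else 0) ℕ.+ k i)) → (s : Bool) →
                ∃ λ c → (∀ i → ℤ.∣ d i + contribution (p i) c ∣ ℕ.≤ suc (k i))
                      × ((∀ i → ¬ T (p i)) → c ≡ s)
colourElement p unique d k bound s with any? (λ i → T? (p i))
... | yes (o , p-o) = towardZero (d o) , bound′ , λ unowned → contradiction p-o (unowned o)
  where
  bound′ : ∀ i → ℤ.∣ d i + contribution (p i) (towardZero (d o)) ∣ ℕ.≤ suc (k i)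
  bound′ i with p i | bound i | (λ (p-i : T (p i)) → unique p-i p-o)
  ... | false | b | _ = ∣i∣≤k⇒∣i+0∣≤k (d i) b
  ... | true  | b | owner with owner _
  ...   | refl = ∣i+towardZero∣≤ (d i) (k i) b
... | no unowned = s , bound′ , λ _ → refl
  where
  bound′ : ∀ i → ℤ.∣ d i + contribution (p i) s ∣ ℕ.≤ suc (k i)
  bound′ i with p i | bound i | (λ (p-i : T (p i)) → unowned (i , p-i))
  ... | false | b | _     = ∣i∣≤k⇒∣i+0∣≤k (d i) b
  ... | true  | _ | owned = ⊥-elim (owned _)

Disjoint : ∀ {n m} → (Fin n → Vector Bool m) → Set
Disjoint P = ∀ {i j x} → T (P i x) → T (P j x) → i ≡ j

balance : ∀ {n m} (P : Fin n → Vector Bool m) → Disjoint P →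
          (d : Fin n → ℤ) → (∀ i → ℤ.∣ d i ∣ ℕ.≤ suc (size (P i))) → (S : Vector Bool m) →
          ∃ λ S′ → (∀ i → ℤ.∣ d i + bias (P i) S′ ∣ ℕ.≤ 1)
                 × (∀ x → (∀ i → ¬ T (P i x)) → S′ x ≡ S x)
balance {m = zero} P _ d bound S = S , (λ i → ∣i∣≤k⇒∣i+0∣≤k (d i) (bound i)) , λ ()
balance {m = suc m} P disjoint d bound S
  with colourElement (λ i → P i zero) disjoint d (size ∘ tail ∘ P) bound (S zero)
... | c , c-bound , c-unowned
  with balance (tail ∘ P) disjoint (λ i → d i + contribution (P i zero) c) c-bound (tail S)
...   | S′ , balanced , unowned =
  c Vector.∷ S′ ,
  (λ i → subst (λ j → ℤ.∣ j ∣ ℕ.≤ 1) (ℤ.+-assoc (d i) _ _) (balanced i)) ,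
  λ { zero → c-unowned ; (suc x) → unowned x }

record ArePrivateParts {n m} (M P : Fin n → Vector Bool m) : Set where
  field
    private⊆ : ∀ {i x} → T (P i x) → T (M i x)
    private-unique : ∀ {i j x} → T (P i x) → T (M j x) → i ≡ j

  disjoint : Disjoint P
  disjoint p-i p-j = private-unique p-i (private⊆ p-j)

contribution-split : ∀ b p {t s} → (T p → T b) → (¬ T p → T b → t ≡ s) →
                     contribution b t ≡ contribution (b ∧ not p) s + contribution p t
contribution-split true  true  {true}  _ _ = refl
contribution-split true  true  {false} _ _ = refl
contribution-split false true  sub _ = ⊥-elim (sub _)
contribution-split false false _   _ = refl
contribution-split true  false {s = s} _ agree rewrite agree (λ ()) _ =
  sym (ℤ.+-identityʳ (contribution true s))

bias-split : ∀ {n m} {M P : Fin n → Vector Bool m} {S S′ : Vector Bool m} →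
             ArePrivateParts M P → (∀ x → (∀ i → ¬ T (P i x)) → S′ x ≡ S x) →
             ∀ i → bias (M i) S′ ≡ bias (M i ∖ P i) S + bias (P i) S′
bias-split {M = M} {P} {S} {S′} parts agree i =
  trans (sum-cong-≗ pointwise) (∑-distrib-+ outside inside)
  where
  open ArePrivateParts parts
  outside inside : Vector ℤ _
  outside x = contribution ((M i ∖ P i) x) (S x)
  inside  x = contribution (P i x) (S′ x)
  pointwise : ∀ x → contribution (M i x) (S′ x) ≡ outside x + inside x
  pointwise x = contribution-split (M i x) (P i x) private⊆ λ ¬p-i m-i →
    agree x λ j p-j → ¬p-i (subst (λ k → T (P k x)) (private-unique p-j m-i) p-j)

size-lookup : ∀ {m} (v : Subset m) → ∣ v ∣ ≡ size (lookup v)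
size-lookup []          = refl
size-lookup (true  ∷ v) = cong suc (size-lookup v)
size-lookup (false ∷ v) = size-lookup v

bias-lookup : ∀ {m} (u w : Subset m) → + ∣ u ∩ w ∣ - + ∣ u ∩ ∁ w ∣ ≡ bias (lookup u) (lookup w)
bias-lookup []          []          = refl
bias-lookup (true  ∷ u) (true  ∷ w) =
  trans (ℤ.+-assoc 1ℤ (+ ∣ u ∩ w ∣) (ℤ.- + ∣ u ∩ ∁ w ∣)) (cong (_+_ 1ℤ) (bias-lookup u w))
bias-lookup (true  ∷ u) (false ∷ w) =
  trans (cong (_+_ (+ ∣ u ∩ w ∣)) (ℤ.neg-suc ∣ u ∩ ∁ w ∣))
        (trans (ℤ.+-pred (+ ∣ u ∩ w ∣) (ℤ.- + ∣ u ∩ ∁ w ∣)) (cong (_+_ -1ℤ) (bias-lookup u w)))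
bias-lookup (false ∷ u) (_     ∷ w) =
  trans (bias-lookup u w) (sym (ℤ.+-identityˡ (bias (lookup u) (lookup w))))

bias-cong : ∀ {m} {B B′ S S′ : Vector Bool m} → B ≗ B′ → S ≗ S′ → bias B S ≡ bias B′ S′
bias-cong B≗B′ S≗S′ = sum-cong-≗ λ x → cong₂ contribution (B≗B′ x) (S≗S′ x)

∣p∣≡∣p∩q∣+∣p∩∁q∣ : ∀ {m} (p q : Subset m) → ∣ p ∣ ≡ ∣ p ∩ q ∣ ℕ.+ ∣ p ∩ ∁ q ∣
∣p∣≡∣p∩q∣+∣p∩∁q∣ []          []          = refl
∣p∣≡∣p∩q∣+∣p∩∁q∣ (true  ∷ p) (true  ∷ q) = cong suc (∣p∣≡∣p∩q∣+∣p∩∁q∣ p q)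
∣p∣≡∣p∩q∣+∣p∩∁q∣ (true  ∷ p) (false ∷ q) =
  trans (cong suc (∣p∣≡∣p∩q∣+∣p∩∁q∣ p q)) (sym (ℕ.+-suc _ _))
∣p∣≡∣p∩q∣+∣p∩∁q∣ (false ∷ p) (_     ∷ q) = ∣p∣≡∣p∩q∣+∣p∩∁q∣ p q

∣m⊖n∣≤1⇒m≡n⊎m≡1+n⊎n≡1+m : ∀ m n → ℤ.∣ m ⊖ n ∣ ℕ.≤ 1 → m ≡ n ⊎ m ≡ suc n ⊎ n ≡ suc m
∣m⊖n∣≤1⇒m≡n⊎m≡1+n⊎n≡1+m zero          zero          _        = inj₁ refl
∣m⊖n∣≤1⇒m≡n⊎m≡1+n⊎n≡1+m zero          (suc zero)    _        = inj₂ (inj₂ refl)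
∣m⊖n∣≤1⇒m≡n⊎m≡1+n⊎n≡1+m zero          (suc (suc n)) (s≤s ())
∣m⊖n∣≤1⇒m≡n⊎m≡1+n⊎n≡1+m (suc zero)    zero          _        = inj₂ (inj₁ refl)
∣m⊖n∣≤1⇒m≡n⊎m≡1+n⊎n≡1+m (suc (suc m)) zero          (s≤s ())
∣m⊖n∣≤1⇒m≡n⊎m≡1+n⊎n≡1+m (suc m)       (suc n)       h
  rewrite ℤ.[1+m]⊖[1+n]≡m⊖n m n =
  ⊎-map (cong suc) (⊎-map (cong suc) (cong suc)) (∣m⊖n∣≤1⇒m≡n⊎m≡1+n⊎n≡1+m m n h)

∣m-n∣≤1⇒m≡⌊m+n/2⌋⊎m≡⌈m+n/2⌉ : ∀ m n → ℤ.∣ + m - + n ∣ ℕ.≤ 1 → m ≡ ⌊ m ℕ.+ n /2⌋ ⊎ m ≡ ⌈ m ℕ.+ n /2⌉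
∣m-n∣≤1⇒m≡⌊m+n/2⌋⊎m≡⌈m+n/2⌉ m n h rewrite ℤ.m-n≡m⊖n m n with ∣m⊖n∣≤1⇒m≡n⊎m≡1+n⊎n≡1+m m n h
... | inj₁ refl        = inj₁ (ℕ.n≡⌊n+n/2⌋ m)
... | inj₂ (inj₁ refl) = inj₂ (cong suc (ℕ.n≡⌊n+n/2⌋ n))
... | inj₂ (inj₂ refl) = inj₁ (trans (ℕ.n≡⌈n+n/2⌉ m) (cong ⌊_/2⌋ (sym (ℕ.+-suc m m))))

+m≤i∧i-1≤+n⇒m≤1+n : ∀ {m n i} → + m ≤ i → i - 1ℤ ≤ + n → m ℕ.≤ suc n
+m≤i∧i-1≤+n⇒m≤1+n {n = n} {i} m≤i i-1≤n =
  ℤ.drop‿+≤+ (ℤ.≤-trans m≤i (subst (_≤ + suc n) (1+[i-1]≡i i) (ℤ.+-monoʳ-≤ 1ℤ i-1≤n)))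
  where
  1+[i-1]≡i : ∀ i → 1ℤ + (i - 1ℤ) ≡ i
  1+[i-1]≡i = solve-∀

inOther-intro : ∀ {n m} (B : Collection n m) {i j x} → j ≢ i → T (lookup (B j) x) → T (inOther B i x)
inOther-intro B {i} {j} {x} j≢i j∋x = any⁺ _ (lose (∈-allFin j) other)
  where
  other : T (not ⌊ j ≟ i ⌋ ∧ lookup (B j) x)
  other with j ≟ i
  ... | yes j≡i = contradiction j≡i j≢i
  ... | no  _   = j∋x

privatePart-private : ∀ {n m} (B : Collection n m) →
                      ArePrivateParts (lookup ∘ B) (lookup ∘ privatePart B)
privatePart-private B = record
  { private⊆       = proj₁ ∘ owned
  ; private-unique = unique
  }
  where
  owned : ∀ {i x} → T (lookup (privatePart B i) x) → T (lookup (B i) x) × T (not (inOther B i x))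
  owned {i} {x} = Equivalence.to T-∧ ∘ subst T (lookup∘tabulate _ x)

  unique : ∀ {i j x} → T (lookup (privatePart B i) x) → T (lookup (B j) x) → i ≡ j
  unique {i} {j} {x} p-i j∋x with j ≟ i
  ... | yes j≡i = sym j≡i
  ... | no  j≢i with inOther B i x | proj₂ (owned p-i) | inOther-intro B j≢i j∋x
  ...   | true  | () | _
  ...   | false | _  | ()

balanced⇒HalfSplittable : ∀ {n m} (B : Collection n m) (S : Vector Bool m) →
                          (∀ i → ℤ.∣ bias (lookup (B i)) S ∣ ℕ.≤ 1) → HalfSplittable B
balanced⇒HalfSplittable B S balanced = tabulate S , λ i → halves (B i) (balanced i)
  where
  halves : ∀ u → ℤ.∣ bias (lookup u) S ∣ ℕ.≤ 1 →
           ∣ u ∩ tabulate S ∣ ≡ ⌊ ∣ u ∣ /2⌋ ⊎ ∣ u ∩ tabulate S ∣ ≡ ⌈ ∣ u ∣ /2⌉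
  halves u h rewrite ∣p∣≡∣p∩q∣+∣p∩∁q∣ u (tabulate S) =
    ∣m-n∣≤1⇒m≡⌊m+n/2⌋⊎m≡⌈m+n/2⌉ _ _ (subst (λ j → ℤ.∣ j ∣ ℕ.≤ 1) (sym bias-u) h)
    where
    bias-u : + ∣ u ∩ tabulate S ∣ - + ∣ u ∩ ∁ (tabulate S) ∣ ≡ bias (lookup u) S
    bias-u = trans (bias-lookup u (tabulate S)) (bias-cong (λ _ → refl) (lookup∘tabulate S))

theorem4p4 : (n : ℕ) → n ≥ 1 → (D : ℤ)
    → (∀ (m : ℕ) (C : Collection n m) → DiscAtMost C D)
    → ∀ (m : ℕ) (B : Collection n m)
    → (∀ (i : Fin n) → D - 1ℤ ≤ + ∣ privatePart B i ∣)
    → HalfSplittable B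
theorem4p4 n _ D disc m B private-large =
  let S₀ , shared-small   = disc m shared
      S  , balanced , agrees = balance P disjoint (λ i → bias (M i ∖ P i) (lookup S₀))
                                       (shared-bound shared-small) (lookup S₀)
  in balanced⇒HalfSplittable B S λ i →
       subst (λ j → ℤ.∣ j ∣ ℕ.≤ 1) (sym (bias-split parts agrees i)) (balanced i)
  where
  M P : Fin n → Vector Bool m
  M = lookup ∘ B
  P = lookup ∘ privatePart B

  parts : ArePrivateParts M P
  parts = privatePart-private B
  open ArePrivateParts parts using (disjoint)

  shared : Collection n m
  shared i = tabulate (M i ∖ P i)

  shared-bound : ∀ {S₀} → (∀ i → + imbalance (shared i) S₀ ≤ D) →
                 ∀ i → ℤ.∣ bias (M i ∖ P i) (lookup S₀) ∣ ℕ.≤ suc (size (P i))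
  shared-bound {S₀} shared-small i = +m≤i∧i-1≤+n⇒m≤1+n
    (subst (λ j → + ℤ.∣ j ∣ ≤ D)
           (trans (bias-lookup (shared i) S₀) (bias-cong (lookup∘tabulate (M i ∖ P i)) λ _ → refl))
           (shared-small i))
    (subst (λ k → D - 1ℤ ≤ + k) (size-lookup (privatePart B i)) (private-large i))
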